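{- If $\Gamma\vdash\mathbf t+\mathbf r:S$ is derivable in $\lambda^{\mathrm{vec}}_{\mathrm R}$, then there exist types $T,R$ such that $S\equiv T+R$, $\Gamma\vdash\mathbf t:T$ is derivable and $\Gamma\vdash\mathbf r:R$ is derivable.
   Context: Fix a commutative ring $(\mathsf S,+,\times)$ of scalars. Terms: $\mathbf t ::= x\mid \lambda x.\mathbf t\mid (\mathbf t)\,\mathbf t\mid \alpha\cdot\mathbf t\mid \mathbf t+\mathbf t$, $\alpha\in\mathsf S$. Types: general $T::=U\mid\alpha\cdot T\mid T+T\mid\mathbb X$, unit $U::=X\mid U\to T\mid\forall X.U\mid\forall\mathbb X.U$ ($X$ unit type variables, $\mathbb X$ general type variables). $\equiv$ is the smallest congruence with $1\cdot T\equiv T$, $\alpha\cdot(\beta\cdot T)\equiv(\alpha\times\beta)\cdot T$, $\alpha\cdot T+\alpha\cdot R\equiv\alpha\cdot(T+R)$, $\alpha\cdot T+\beta\cdot T\equiv(\alpha+\beta)\cdot T$, $T+R\equiv R+T$, $T+(R+S)\equiv(T+R)+S$. In $T[A/X]$, $A$ is unit when $X$ is a unit variable. Contexts are finite sets of $x:U$ with $U$ unit. Typing rules: (ax) $\Gamma,x:U\vdash x:U$; ($\equiv$) from $\Gamma\vdash\mathbf t:T$, $R\equiv T$ infer $\Gamma\vdash\mathbf t:R$; ($\to_I$) from $\Gamma,x:U\vdash\mathbf t:T$ infer $\Gamma\vdash\lambda x.\mathbf t:U\to T$; ($\to_E$) from $\Gamma\vdash\mathbf t:\sum_{i=1}^n\alpha_i\cdot\forall\vec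 X.(U\to T_i)$ and $\Gamma\vdash\mathbf r:\sum_{j=1}^m\beta_j\cdot U[\vec A_j/\vec X]$ infer $\Gamma\vdash(\mathbf t)\,\mathbf r:\sum_{i}\sum_{j}(\alpha_i\times\beta_j)\cdot T_i[\vec A_j/\vec X]$; ($\forall_I$) from $\Gamma\vdash\mathbf t:\sum_i\alpha_i\cdot U_i$, $X\notin FV(\Gamma)$ infer $\Gamma\vdash\mathbf t:\sum_i\alpha_i\cdot\forall X.U_i$; ($\forall_E$) from $\Gamma\vdash\mathbf t:\sum_i\alpha_i\cdot\forall X.U_i$ infer $\Gamma\vdash\mathbf t:\sum_i\alpha_i\cdot U_i[A/X]$; ($+_I$) from $\Gamma\vdash\mathbf t:T$, $\Gamma\vdash\mathbf r:R$ infer $\Gamma\vdash\mathbf t+\mathbf r:T+R$; ($1_E$) from $\Gamma\vdash1\cdot\mathbf t:T$ infer $\Gamma\vdash\mathbf t:T$; ($S$) from $\Gamma\vdash\mathbf t:T_i$ for all $i\in\{1,\dots,n\}$ infer $\Gamma\vdash(\sum_i\alpha_i)\cdot\mathbf t:\sum_i\alpha_i\cdot T_i$. -}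

module Defs where

open import Data.Nat using (ℕ; zero; suc)
open import Data.Fin using (Fin; zero; suc)
open import Data.List using (List; []; _∷_; map)
open import Data.List.Relation.Unary.All using (All; []; _∷_)
open import Data.Product using (_×_; _,_; proj₁; proj₂)
open import Relation.Binary.PropositionalEquality using (_≡_)
open import Algebra.Structures using (IsCommutativeRing)
open import Function using (_∘_; id)

record Scalars : Set₁ where
  infixl 6 _+_
  infixl 7 _*_
  field
    Carrier           : Set
    _+_ _*_           : Carrier → Carrier → Carrier
    -_                : Carrier → Carrier
    0# 1#             : Carrier
    isCommutativeRing : IsCommutativeRing _≡_ _+_ _*_ -_ 0# 1#

data Kind : Set where
  unitK genK : Kind

module System (𝕊 : Scalars) where
  open Scalars 𝕊 renaming (Carrier to S)

  -- Terms (de Bruijn indices for term variables)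
  infixl 6 _+ₜ_
  infixr 7 _·ₜ_
  data Term : Set where
    var  : ℕ → Term
    ƛ_   : Term → Term
    _$_  : Term → Term → Term
    _·ₜ_ : S → Term → Term
    _+ₜ_ : Term → Term → Term

  -- Types.  Two separate de Bruijn namespaces: unit variables X (uvar)
  -- and general variables 𝕏 (gvar).  ∀ᵤ binds a unit variable, ∀ₓ a
  -- general one.
  infixr 5 _⇒_
  infixl 6 _+ᵀ_
  infixr 7 _·ᵀ_
  mutual
    data UTy : Set where
      uvar : ℕ → UTy
      _⇒_  : UTy → Ty → UTy
      ∀ᵤ   : UTy → UTy
      ∀ₓ   : UTy → UTy

    data Ty : Set where
      ⌜_⌝  : UTy → Ty
      _·ᵀ_ : S → Ty → Ty
      _+ᵀ_ : Ty → Ty → Ty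
      gvar : ℕ → Ty

  ∀[_]_ : Kind → UTy → UTy
  ∀[ unitK ] U = ∀ᵤ U
  ∀[ genK ]  U = ∀ₓ U

  -- ∀X⃗.U : the head of the list is the innermost binder.
  ∀*[_]_ : List Kind → UTy → UTy
  ∀*[ [] ] U     = U
  ∀*[ k ∷ ks ] U = ∀*[ ks ] (∀[ k ] U)

  ext : (ℕ → ℕ) → ℕ → ℕ
  ext ρ zero    = zero
  ext ρ (suc n) = suc (ρ n)

  mutual
    renU : (ℕ → ℕ) → (ℕ → ℕ) → UTy → UTy
    renU ρu ρg (uvar n) = uvar (ρu n)
    renU ρu ρg (U ⇒ T)  = renU ρu ρg U ⇒ renT ρu ρg T
    renU ρu ρg (∀ᵤ U)   = ∀ᵤ (renU (ext ρu) ρg U)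
    renU ρu ρg (∀ₓ U)   = ∀ₓ (renU ρu (ext ρg) U)

    renT : (ℕ → ℕ) → (ℕ → ℕ) → Ty → Ty
    renT ρu ρg ⌜ U ⌝    = ⌜ renU ρu ρg U ⌝
    renT ρu ρg (α ·ᵀ T) = α ·ᵀ renT ρu ρg T
    renT ρu ρg (T +ᵀ R) = renT ρu ρg T +ᵀ renT ρu ρg R
    renT ρu ρg (gvar n) = gvar (ρg n)

  shift : Kind → UTy → UTy
  shift unitK = renU suc id
  shift genK  = renU id suc

  extsU : (ℕ → UTy) → ℕ → UTy
  extsU σ zero    = uvar zero
  extsU σ (suc n) = renU suc id (σ n)

  extsG : (ℕ → Ty) → ℕ → Ty
  extsG σ zero    = gvar zero
  extsG σ (suc n) = renT id suc (σ n)

  mutual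
    subU : (ℕ → UTy) → (ℕ → Ty) → UTy → UTy
    subU σu σg (uvar n) = σu n
    subU σu σg (U ⇒ T)  = subU σu σg U ⇒ subT σu σg T
    subU σu σg (∀ᵤ U)   = ∀ᵤ (subU (extsU σu) (renT suc id ∘ σg) U)
    subU σu σg (∀ₓ U)   = ∀ₓ (subU (renU id suc ∘ σu) (extsG σg) U)

    subT : (ℕ → UTy) → (ℕ → Ty) → Ty → Ty
    subT σu σg ⌜ U ⌝    = ⌜ subU σu σg U ⌝
    subT σu σg (α ·ᵀ T) = α ·ᵀ subT σu σg T
    subT σu σg (T +ᵀ R) = subT σu σg T +ᵀ subT σu σg R
    subT σu σg (gvar n) = σg n

  data Arg : Kind → Set where
    uarg : UTy → Arg unitK
    garg : Ty  → Arg genK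

  cons : {A : Set} → A → (ℕ → A) → ℕ → A
  cons a f zero    = a
  cons a f (suc n) = f n

  -- The simultaneous substitution [A⃗/X⃗] instantiating the binders of ∀*[ ks ]
  -- (head of the list = innermost binder = index 0 of its namespace).
  instσ : {ks : List Kind} → All Arg ks → (ℕ → UTy) × (ℕ → Ty)
  instσ []             = uvar , gvar
  instσ (uarg A ∷ as)  = cons A (proj₁ (instσ as)) , proj₂ (instσ as)
  instσ (garg A ∷ as)  = proj₁ (instσ as) , cons A (proj₂ (instσ as))

  _[_]ᵘ : {ks : List Kind} → UTy → All Arg ks → UTy
  U [ as ]ᵘ = subU (proj₁ (instσ as)) (proj₂ (instσ as)) U

  _[_]ᵗ : {ks : List Kind} → Ty → All Arg ks → Ty
  T [ as ]ᵗ = subT (proj₁ (instσ as)) (proj₂ (instσ as)) T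

  ΣT : (n : ℕ) → (Fin (suc n) → Ty) → Ty
  ΣT zero    f = f zero
  ΣT (suc n) f = f zero +ᵀ ΣT n (f ∘ suc)

  ΣS : (n : ℕ) → (Fin (suc n) → S) → S
  ΣS zero    f = f zero
  ΣS (suc n) f = f zero + ΣS n (f ∘ suc)

  infix 4 _≡ᵘ_ _≡ᵀ_
  mutual
    data _≡ᵘ_ : UTy → UTy → Set where
      reflᵘ  : ∀ {U} → U ≡ᵘ U
      symᵘ   : ∀ {U V} → U ≡ᵘ V → V ≡ᵘ U
      transᵘ : ∀ {U V W} → U ≡ᵘ V → V ≡ᵘ W → U ≡ᵘ W
      ⇒-cong : ∀ {U U' T T'} → U ≡ᵘ U' → T ≡ᵀ T' → (U ⇒ T) ≡ᵘ (U' ⇒ T')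
      ∀ᵤ-cong : ∀ {U U'} → U ≡ᵘ U' → ∀ᵤ U ≡ᵘ ∀ᵤ U'
      ∀ₓ-cong : ∀ {U U'} → U ≡ᵘ U' → ∀ₓ U ≡ᵘ ∀ₓ U'

    data _≡ᵀ_ : Ty → Ty → Set where
      reflᵀ  : ∀ {T} → T ≡ᵀ T
      symᵀ   : ∀ {T R} → T ≡ᵀ R → R ≡ᵀ T
      transᵀ : ∀ {T R Q} → T ≡ᵀ R → R ≡ᵀ Q → T ≡ᵀ Q
      ⌜⌝-cong : ∀ {U U'} → U ≡ᵘ U' → ⌜ U ⌝ ≡ᵀ ⌜ U' ⌝
      ·-cong : ∀ {α T T'} → T ≡ᵀ T' → α ·ᵀ T ≡ᵀ α ·ᵀ T'
      +-cong : ∀ {T T' R R'} → T ≡ᵀ T' → R ≡ᵀ R' → T +ᵀ R ≡ᵀ T' +ᵀ R'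
      ax-one   : ∀ {T} → 1# ·ᵀ T ≡ᵀ T
      ax-mul   : ∀ {α β T} → α ·ᵀ (β ·ᵀ T) ≡ᵀ (α * β) ·ᵀ T
      ax-dist  : ∀ {α T R} → α ·ᵀ T +ᵀ α ·ᵀ R ≡ᵀ α ·ᵀ (T +ᵀ R)
      ax-fact  : ∀ {α β T} → α ·ᵀ T +ᵀ β ·ᵀ T ≡ᵀ (α + β) ·ᵀ T
      ax-comm  : ∀ {T R} → T +ᵀ R ≡ᵀ R +ᵀ T
      ax-assoc : ∀ {T R Q} → T +ᵀ (R +ᵀ Q) ≡ᵀ (T +ᵀ R) +ᵀ Q

  Ctx : Set
  Ctx = List UTy

  data _∋_∶_ : Ctx → ℕ → UTy → Set where
    here  : ∀ {Γ U} → (U ∷ Γ) ∋ zero ∶ U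
    there : ∀ {Γ U V n} → Γ ∋ n ∶ U → (V ∷ Γ) ∋ suc n ∶ U

  infix 3 _⊢_∶_
  data _⊢_∶_ : Ctx → Term → Ty → Set where
    ax   : ∀ {Γ x U} → Γ ∋ x ∶ U → Γ ⊢ var x ∶ ⌜ U ⌝
    ≡-r  : ∀ {Γ t T R} → Γ ⊢ t ∶ T → R ≡ᵀ T → Γ ⊢ t ∶ R
    →I   : ∀ {Γ t U T} → (U ∷ Γ) ⊢ t ∶ T → Γ ⊢ ƛ t ∶ ⌜ U ⇒ T ⌝
    →E   : ∀ {Γ t r n m} {ks : List Kind} {U : UTy}
             {α : Fin (suc n) → S} {T : Fin (suc n) → Ty}
             {β : Fin (suc m) → S} {A : Fin (suc m) → All Arg ks} →
           Γ ⊢ t ∶ ΣT n (λ i → α i ·ᵀ ⌜ ∀*[ ks ] (U ⇒ T i) ⌝) →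
           Γ ⊢ r ∶ ΣT m (λ j → β j ·ᵀ ⌜ U [ A j ]ᵘ ⌝) →
           Γ ⊢ t $ r ∶ ΣT n (λ i → ΣT m (λ j → (α i * β j) ·ᵀ (T i [ A j ]ᵗ)))
    ∀I   : ∀ {Γ t n} (k : Kind) {α : Fin (suc n) → S} {U : Fin (suc n) → UTy} →
           map (shift k) Γ ⊢ t ∶ ΣT n (λ i → α i ·ᵀ ⌜ U i ⌝) →
           Γ ⊢ t ∶ ΣT n (λ i → α i ·ᵀ ⌜ ∀[ k ] U i ⌝)
    ∀E   : ∀ {Γ t n} {k : Kind} {α : Fin (suc n) → S} {U : Fin (suc n) → UTy} →
           Γ ⊢ t ∶ ΣT n (λ i → α i ·ᵀ ⌜ ∀[ k ] U i ⌝) → (A : Arg k) →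
           Γ ⊢ t ∶ ΣT n (λ i → α i ·ᵀ ⌜ U i [ A ∷ [] ]ᵘ ⌝)
    +I   : ∀ {Γ t r T R} → Γ ⊢ t ∶ T → Γ ⊢ r ∶ R → Γ ⊢ t +ₜ r ∶ T +ᵀ R
    1E   : ∀ {Γ t T} → Γ ⊢ 1# ·ₜ t ∶ T → Γ ⊢ t ∶ T
    SI   : ∀ {Γ t} (n : ℕ) (α : Fin (suc n) → S) (T : Fin (suc n) → Ty) →
           ((i : Fin (suc n)) → Γ ⊢ t ∶ T i) →
           Γ ⊢ ΣS n α ·ₜ t ∶ ΣT n (λ i → α i ·ᵀ T i)

-- A derivation of t + r need not end with +I: ≡, ∀I, ∀E and 1E may come after it,
-- and 1E needs a derivation of 1·(t + r), which may itself end with S.  One therefore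
-- inducts over derivations of c₁·…·cₖ·(t + r), splitting them into derivations of
-- c₁·…·cₖ·t and c₁·…·cₖ·r; for S the scalars distribute over the split.  For ∀I and
-- ∀E the type is a sum Σ α_i·U_i of scaled unit types on which the rule acts unit by
-- unit.  Equivalence preserves being such a sum, together with the side condition of
-- ∀E that every unit is quantified over a variable of the right kind, so each part of
-- the split is again equivalent to such a sum and the rule applies to it.
module Submission where

open import Defs
open import Data.Product using (Σ; _×_; _,_; proj₁; proj₂; map₁; map₂; swap; assocˡ′; assocʳ′)
open import Data.Nat using (ℕ; zero; suc; _+_)
open import Data.Fin using (Fin; zero; suc; splitAt)
open import Data.Maybe using (Maybe; just; nothing)
open import Data.List using (map)
open import Data.List.Relation.Unary.All using ([]; _∷_)
open import Data.Vec.Functional using (_++_)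
open import Data.Vec.Functional.Relation.Unary.All using (All)
open import Data.Vec.Functional.Relation.Unary.All.Properties using (++⁺)
open import Data.Sum.Properties using ([,]-map)
open import Data.Product.Function.NonDependent.Propositional using (_×-⇔_)
open import Data.Unit using (⊤)
open import Data.Empty using (⊥)
open import Function using (_∘_; id; _⇔_; mk⇔; Equivalence)
import Function.Properties.Equivalence as ⇔
open import Relation.Binary.PropositionalEquality
  using (_≡_; refl; cong)
  renaming (sym to ≡-sym; trans to ≡-trans)

module Generation (𝕊 : Scalars) where
  open Scalars 𝕊 using (1#; _*_) renaming (Carrier to Scalar)
  open System 𝕊

  ≡⇒≡ᵀ : ∀ {T T'} → T ≡ T' → T ≡ᵀ T'
  ≡⇒≡ᵀ refl = reflᵀ

  ΣT-cong : ∀ n {f g : Fin (suc n) → Ty} → (∀ i → f i ≡ᵀ g i) → ΣT n f ≡ᵀ ΣT n g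
  ΣT-cong zero    f≡g = f≡g zero
  ΣT-cong (suc n) f≡g = +-cong (f≡g zero) (ΣT-cong n (f≡g ∘ suc))

  ΣT-cong-≗ : ∀ n {f g : Fin (suc n) → Ty} → (∀ i → f i ≡ g i) → ΣT n f ≡ᵀ ΣT n g
  ΣT-cong-≗ n f≗g = ΣT-cong n (≡⇒≡ᵀ ∘ f≗g)

  +ᵀ-interchange : ∀ {T R Q P} → (T +ᵀ R) +ᵀ (Q +ᵀ P) ≡ᵀ (T +ᵀ Q) +ᵀ (R +ᵀ P)
  +ᵀ-interchange =
    transᵀ (symᵀ ax-assoc)
      (transᵀ (+-cong reflᵀ (transᵀ ax-assoc (transᵀ (+-cong ax-comm reflᵀ) (symᵀ ax-assoc))))
        ax-assoc)

  ΣT-+ : ∀ n (f g : Fin (suc n) → Ty) → ΣT n (λ i → f i +ᵀ g i) ≡ᵀ ΣT n f +ᵀ ΣT n g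
  ΣT-+ zero    f g = reflᵀ
  ΣT-+ (suc n) f g = transᵀ (+-cong reflᵀ (ΣT-+ n (f ∘ suc) (g ∘ suc))) +ᵀ-interchange

  ·ᵀ-distrib-ΣT : ∀ n α (f : Fin (suc n) → Ty) → α ·ᵀ ΣT n f ≡ᵀ ΣT n (λ i → α ·ᵀ f i)
  ·ᵀ-distrib-ΣT zero    α f = reflᵀ
  ·ᵀ-distrib-ΣT (suc n) α f = transᵀ (symᵀ ax-dist) (+-cong reflᵀ (·ᵀ-distrib-ΣT n α (f ∘ suc)))

  ΣT-++ : ∀ {A : Set} n m (h : A → Ty) (f : Fin (suc n) → A) (g : Fin (suc m) → A) →
          ΣT n (h ∘ f) +ᵀ ΣT m (h ∘ g) ≡ᵀ ΣT (n + suc m) (h ∘ (f ++ g))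
  ΣT-++ zero    m h f g = reflᵀ
  ΣT-++ (suc n) m h f g =
    transᵀ (symᵀ ax-assoc)
      (+-cong reflᵀ (transᵀ (ΣT-++ n m h (f ∘ suc) g)
        (ΣT-cong-≗ (n + suc m) (λ i → cong h (≡-sym ([,]-map (splitAt (suc n) i)))))))

  ΣT-cong-units : ∀ n (α : Fin (suc n) → Scalar) {U V : Fin (suc n) → UTy} → (∀ i → U i ≡ V i) →
                  ΣT n (λ i → α i ·ᵀ ⌜ U i ⌝) ≡ᵀ ΣT n (λ i → α i ·ᵀ ⌜ V i ⌝)
  ΣT-cong-units n α U≗V = ΣT-cong-≗ n (λ i → cong (λ W → α i ·ᵀ ⌜ W ⌝) (U≗V i))

  scaledUnit : Scalar × UTy → Ty
  scaledUnit (α , U) = α ·ᵀ ⌜ U ⌝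

  ΣU : (n : ℕ) → (Fin (suc n) → Scalar × UTy) → Ty
  ΣU n ps = ΣT n (scaledUnit ∘ ps)

  Resp : (UTy → Set) → Set
  Resp P = ∀ {U U'} → U ≡ᵘ U' → P U ⇔ P U'

  AllUnits : (UTy → Set) → Ty → Set
  AllUnits P ⌜ U ⌝    = P U
  AllUnits P (α ·ᵀ T) = AllUnits P T
  AllUnits P (T +ᵀ R) = AllUnits P T × AllUnits P R
  AllUnits P (gvar _) = ⊥

  AllUnits-resp : ∀ {P} → Resp P → ∀ {T T'} → T ≡ᵀ T' → AllUnits P T ⇔ AllUnits P T'
  AllUnits-resp resp reflᵀ           = mk⇔ id id
  AllUnits-resp resp (symᵀ e)        = ⇔.sym (AllUnits-resp resp e)
  AllUnits-resp resp (transᵀ e e')   = ⇔.trans (AllUnits-resp resp e) (AllUnits-resp resp e')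
  AllUnits-resp resp (⌜⌝-cong e)     = resp e
  AllUnits-resp resp (·-cong e)      = AllUnits-resp resp e
  AllUnits-resp resp (+-cong e e')   = AllUnits-resp resp e ×-⇔ AllUnits-resp resp e'
  AllUnits-resp resp ax-one          = mk⇔ id id
  AllUnits-resp resp ax-mul          = mk⇔ id id
  AllUnits-resp resp ax-dist         = mk⇔ id id
  AllUnits-resp resp ax-fact         = mk⇔ proj₁ (λ a → a , a)
  AllUnits-resp resp ax-comm         = mk⇔ swap swap
  AllUnits-resp resp ax-assoc        = mk⇔ assocˡ′ assocʳ′

  AllUnits-ΣU : ∀ {P} n (ps : Fin (suc n) → Scalar × UTy) →
                All (P ∘ proj₂) ps → AllUnits P (ΣU n ps)
  AllUnits-ΣU zero    ps all = all zero
  AllUnits-ΣU (suc n) ps all = all zero , AllUnits-ΣU n (ps ∘ suc) (all ∘ suc)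

  record UnitSum (P : UTy → Set) (T : Ty) : Set where
    field
      size      : ℕ
      summands  : Fin (suc size) → Scalar × UTy
      ≡-ΣU      : T ≡ᵀ ΣU size summands
      all-units : All (P ∘ proj₂) summands

  toUnitSum : ∀ {P} T → AllUnits P T → UnitSum P T
  toUnitSum ⌜ U ⌝ a = record
    { size = 0 ; summands = λ _ → 1# , U ; ≡-ΣU = symᵀ ax-one ; all-units = λ _ → a }
  toUnitSum (α ·ᵀ T) a = record
    { size      = size
    ; summands  = map₁ (α *_) ∘ summands
    ; ≡-ΣU      = transᵀ (·-cong ≡-ΣU)
                    (transᵀ (·ᵀ-distrib-ΣT size α (scaledUnit ∘ summands)) (ΣT-cong size (λ _ → ax-mul)))
    ; all-units = all-units
    }
    where open UnitSum (toUnitSum T a)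
  toUnitSum {P} (T +ᵀ R) (a , b) = record
    { size      = T.size + suc R.size
    ; summands  = T.summands ++ R.summands
    ; ≡-ΣU      = transᵀ (+-cong T.≡-ΣU R.≡-ΣU)
                    (ΣT-++ T.size R.size scaledUnit T.summands R.summands)
    ; all-units = ++⁺ (P ∘ proj₂) T.all-units R.all-units
    }
    where
    module T = UnitSum (toUnitSum T a)
    module R = UnitSum (toUnitSum R b)

  mapUnits : (UTy → UTy) → Ty → Ty
  mapUnits G ⌜ U ⌝    = ⌜ G U ⌝
  mapUnits G (α ·ᵀ T) = α ·ᵀ mapUnits G T
  mapUnits G (T +ᵀ R) = mapUnits G T +ᵀ mapUnits G R
  mapUnits G (gvar n) = gvar n

  mapUnits-resp : ∀ G → (∀ {U U'} → U ≡ᵘ U' → G U ≡ᵘ G U') →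
                  ∀ {T T'} → T ≡ᵀ T' → mapUnits G T ≡ᵀ mapUnits G T'
  mapUnits-resp G resp reflᵀ         = reflᵀ
  mapUnits-resp G resp (symᵀ e)      = symᵀ (mapUnits-resp G resp e)
  mapUnits-resp G resp (transᵀ e e') = transᵀ (mapUnits-resp G resp e) (mapUnits-resp G resp e')
  mapUnits-resp G resp (⌜⌝-cong e)   = ⌜⌝-cong (resp e)
  mapUnits-resp G resp (·-cong e)    = ·-cong (mapUnits-resp G resp e)
  mapUnits-resp G resp (+-cong e e') = +-cong (mapUnits-resp G resp e) (mapUnits-resp G resp e')
  mapUnits-resp G resp ax-one        = ax-one
  mapUnits-resp G resp ax-mul        = ax-mul
  mapUnits-resp G resp ax-dist       = ax-dist
  mapUnits-resp G resp ax-fact       = ax-fact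
  mapUnits-resp G resp ax-comm       = ax-comm
  mapUnits-resp G resp ax-assoc      = ax-assoc

  mapUnits-ΣU : ∀ G n (ps : Fin (suc n) → Scalar × UTy) → mapUnits G (ΣU n ps) ≡ ΣU n (map₂ G ∘ ps)
  mapUnits-ΣU G zero    ps = refl
  mapUnits-ΣU G (suc n) ps = cong (scaledUnit (map₂ G (ps zero)) +ᵀ_) (mapUnits-ΣU G n (ps ∘ suc))

  record Splits (Γ : Ctx) (t r : Term) (S : Ty) : Set where
    constructor splits
    field
      left right : Ty
      ≡-+        : S ≡ᵀ left +ᵀ right
      ⊢left      : Γ ⊢ t ∶ left
      ⊢right     : Γ ⊢ r ∶ right

  Splits-≡ᵀ : ∀ {Γ t r S S'} → S ≡ᵀ S' → Splits Γ t r S' → Splits Γ t r S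
  Splits-≡ᵀ e (splits T R e' dt dr) = splits T R (transᵀ e e') dt dr

  Splits-SI : ∀ {Γ t r} n α (Ts : Fin (suc n) → Ty) → (∀ i → Splits Γ t r (Ts i)) →
              Splits Γ (ΣS n α ·ₜ t) (ΣS n α ·ₜ r) (ΣT n (λ i → α i ·ᵀ Ts i))
  Splits-SI n α Ts s = splits
    (ΣT n (λ i → α i ·ᵀ left (s i))) (ΣT n (λ i → α i ·ᵀ right (s i)))
    (transᵀ (ΣT-cong n (λ i → transᵀ (·-cong (≡-+ (s i))) (symᵀ ax-dist))) (ΣT-+ n _ _))
    (SI n α _ (⊢left ∘ s)) (SI n α _ (⊢right ∘ s))
    where open Splits

  record SummandwiseRule (Δ Γ : Ctx) : Set₁ where
    field
      Applies        : UTy → Set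
      Applies-resp   : Resp Applies
      transform      : UTy → UTy
      transform-resp : ∀ {U U'} → U ≡ᵘ U' → transform U ≡ᵘ transform U'
      rule           : ∀ {t n} (ps : Fin (suc n) → Scalar × UTy) → All (Applies ∘ proj₂) ps →
                       Δ ⊢ t ∶ ΣU n ps → Γ ⊢ t ∶ ΣU n (map₂ transform ∘ ps)

    rule-mapUnits : ∀ {t T} → AllUnits Applies T → Δ ⊢ t ∶ T → Γ ⊢ t ∶ mapUnits transform T
    rule-mapUnits {T = T} a d =
      ≡-r (rule summands all-units (≡-r d (symᵀ ≡-ΣU)))
          (transᵀ (mapUnits-resp transform transform-resp ≡-ΣU)
                  (≡⇒≡ᵀ (mapUnits-ΣU transform size summands)))
      where open UnitSum (toUnitSum T a)

    rule-Splits : ∀ {t r n} (ps : Fin (suc n) → Scalar × UTy) → All (Applies ∘ proj₂) ps →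
                  Splits Δ t r (ΣU n ps) → Splits Γ t r (ΣU n (map₂ transform ∘ ps))
    rule-Splits {n = n} ps all (splits T R e dt dr) =
      let aT , aR = Equivalence.to (AllUnits-resp Applies-resp e) (AllUnits-ΣU n ps all) in
      splits (mapUnits transform T) (mapUnits transform R)
        (transᵀ (≡⇒≡ᵀ (≡-sym (mapUnits-ΣU transform n ps))) (mapUnits-resp transform transform-resp e))
        (rule-mapUnits aT dt) (rule-mapUnits aR dr)

  ∀I-rule : ∀ {Γ} k → SummandwiseRule (map (shift k) Γ) Γ
  ∀I-rule k = record
    { Applies        = λ _ → ⊤
    ; Applies-resp   = λ _ → mk⇔ id id
    ; transform      = ∀[ k ]_
    ; transform-resp = ∀-cong k
    ; rule           = λ ps _ → ∀I k {α = proj₁ ∘ ps} {U = proj₂ ∘ ps}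
    }
    where
    ∀-cong : ∀ k {U U'} → U ≡ᵘ U' → ∀[ k ] U ≡ᵘ ∀[ k ] U'
    ∀-cong unitK = ∀ᵤ-cong
    ∀-cong genK  = ∀ₓ-cong

  mutual
    subU-resp : ∀ σu σg {U U'} → U ≡ᵘ U' → subU σu σg U ≡ᵘ subU σu σg U'
    subU-resp σu σg reflᵘ         = reflᵘ
    subU-resp σu σg (symᵘ p)      = symᵘ (subU-resp σu σg p)
    subU-resp σu σg (transᵘ p q)  = transᵘ (subU-resp σu σg p) (subU-resp σu σg q)
    subU-resp σu σg (⇒-cong p q)  = ⇒-cong (subU-resp σu σg p) (subT-resp σu σg q)
    subU-resp σu σg (∀ᵤ-cong p)   = ∀ᵤ-cong (subU-resp (extsU σu) (renT suc id ∘ σg) p)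
    subU-resp σu σg (∀ₓ-cong p)   = ∀ₓ-cong (subU-resp (renU id suc ∘ σu) (extsG σg) p)

    subT-resp : ∀ σu σg {T T'} → T ≡ᵀ T' → subT σu σg T ≡ᵀ subT σu σg T'
    subT-resp σu σg reflᵀ         = reflᵀ
    subT-resp σu σg (symᵀ e)      = symᵀ (subT-resp σu σg e)
    subT-resp σu σg (transᵀ e e') = transᵀ (subT-resp σu σg e) (subT-resp σu σg e')
    subT-resp σu σg (⌜⌝-cong e)   = ⌜⌝-cong (subU-resp σu σg e)
    subT-resp σu σg (·-cong e)    = ·-cong (subT-resp σu σg e)
    subT-resp σu σg (+-cong e e') = +-cong (subT-resp σu σg e) (subT-resp σu σg e')
    subT-resp σu σg ax-one        = ax-one
    subT-resp σu σg ax-mul        = ax-mul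
    subT-resp σu σg ax-dist       = ax-dist
    subT-resp σu σg ax-fact       = ax-fact
    subT-resp σu σg ax-comm       = ax-comm
    subT-resp σu σg ax-assoc      = ax-assoc

  quantifier : UTy → Maybe Kind
  quantifier (uvar _) = nothing
  quantifier (_ ⇒ _)  = nothing
  quantifier (∀ᵤ _)   = just unitK
  quantifier (∀ₓ _)   = just genK

  quantifier-resp : ∀ {U U'} → U ≡ᵘ U' → quantifier U ≡ quantifier U'
  quantifier-resp reflᵘ        = refl
  quantifier-resp (symᵘ p)     = ≡-sym (quantifier-resp p)
  quantifier-resp (transᵘ p q) = ≡-trans (quantifier-resp p) (quantifier-resp q)
  quantifier-resp (⇒-cong _ _) = refl
  quantifier-resp (∀ᵤ-cong _)  = refl
  quantifier-resp (∀ₓ-cong _)  = refl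

  quantifier-∀ : ∀ k W → quantifier (∀[ k ] W) ≡ just k
  quantifier-∀ unitK W = refl
  quantifier-∀ genK  W = refl

  quantified : ∀ {k} V → quantifier V ≡ just k → Σ UTy (λ W → V ≡ ∀[ k ] W)
  quantified (∀ᵤ W) refl = W , refl
  quantified (∀ₓ W) refl = W , refl

  instantiate : ∀ {k} → Arg k → UTy → UTy
  instantiate A        (uvar n) = uvar n
  instantiate A        (U ⇒ T)  = U ⇒ T
  instantiate (uarg A) (∀ᵤ W)   = W [ uarg A ∷ [] ]ᵘ
  instantiate (garg A) (∀ᵤ W)   = ∀ᵤ W
  instantiate (uarg A) (∀ₓ W)   = ∀ₓ W
  instantiate (garg A) (∀ₓ W)   = W [ garg A ∷ [] ]ᵘ

  instantiate-resp : ∀ {k} (A : Arg k) {U U'} → U ≡ᵘ U' → instantiate A U ≡ᵘ instantiate A U'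
  instantiate-resp A        reflᵘ        = reflᵘ
  instantiate-resp A        (symᵘ p)     = symᵘ (instantiate-resp A p)
  instantiate-resp A        (transᵘ p q) = transᵘ (instantiate-resp A p) (instantiate-resp A q)
  instantiate-resp A        (⇒-cong p q) = ⇒-cong p q
  instantiate-resp (uarg A) (∀ᵤ-cong p)  = subU-resp _ _ p
  instantiate-resp (garg A) (∀ᵤ-cong p)  = ∀ᵤ-cong p
  instantiate-resp (uarg A) (∀ₓ-cong p)  = ∀ₓ-cong p
  instantiate-resp (garg A) (∀ₓ-cong p)  = subU-resp _ _ p

  instantiate-∀ : ∀ {k} (A : Arg k) W → instantiate A (∀[ k ] W) ≡ W [ A ∷ [] ]ᵘ
  instantiate-∀ (uarg A) W = refl
  instantiate-∀ (garg A) W = refl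

  ∀E-rule : ∀ {Γ k} → Arg k → SummandwiseRule Γ Γ
  ∀E-rule {k = k} A = record
    { Applies        = λ U → quantifier U ≡ just k
    ; Applies-resp   = λ p → mk⇔ (≡-trans (≡-sym (quantifier-resp p))) (≡-trans (quantifier-resp p))
    ; transform      = instantiate A
    ; transform-resp = instantiate-resp A
    ; rule           = rule
    }
    where
    rule : ∀ {Γ t n} (ps : Fin (suc n) → Scalar × UTy) → All (λ p → quantifier (proj₂ p) ≡ just k) ps →
           Γ ⊢ t ∶ ΣU n ps → Γ ⊢ t ∶ ΣU n (map₂ (instantiate A) ∘ ps)
    rule {n = n} ps all d =
      ≡-r (∀E {α = proj₁ ∘ ps} {U = body} (≡-r d (symᵀ (ΣT-cong-units n _ unfold))) A)
          (ΣT-cong-units n _ (λ i → ≡-trans (cong (instantiate A) (unfold i)) (instantiate-∀ A (body i))))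
      where
      body : Fin (suc n) → UTy
      body i = proj₁ (quantified (proj₂ (ps i)) (all i))
      unfold : ∀ i → proj₂ (ps i) ≡ ∀[ k ] body i
      unfold i = proj₂ (quantified (proj₂ (ps i)) (all i))

  data Distributes : Term → Term → Term → Set where
    sum   : ∀ {t r} → Distributes (t +ₜ r) t r
    scale : ∀ {e t r} c → Distributes e t r → Distributes (c ·ₜ e) (c ·ₜ t) (c ·ₜ r)

  split : ∀ {Γ e t r S} → Γ ⊢ e ∶ S → Distributes e t r → Splits Γ t r S
  split (ax _)         ()
  split (→I _)         ()
  split (→E _ _)       ()
  split (≡-r d e)      p           = Splits-≡ᵀ e (split d p)
  split (+I dt dr)     sum         = splits _ _ reflᵀ dt dr
  split (1E d)         p           =
    let splits T R e dt dr = split d (scale 1# p) in splits T R e (1E dt) (1E dr)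
  split (SI n α Ts ds) (scale _ p) = Splits-SI n α Ts (λ i → split (ds i) p)
  split (∀I k {α} {U} d) p =
    SummandwiseRule.rule-Splits (∀I-rule k) (λ i → α i , U i) _ (split d p)
  split (∀E {n = n} {k} {α} {U} d A) p =
    Splits-≡ᵀ (ΣT-cong-units n α (λ i → ≡-sym (instantiate-∀ A (U i))))
      (SummandwiseRule.rule-Splits (∀E-rule A) (λ i → α i , ∀[ k ] U i)
        (λ i → quantifier-∀ k (U i)) (split d p))

mainTheorem7 : (𝕊 : Scalars) → let open System 𝕊 in
    (Γ : Ctx) (t r : Term) (S : Ty) →
    Γ ⊢ t +ₜ r ∶ S →
    Σ Ty (λ T → Σ Ty (λ R → (S ≡ᵀ T +ᵀ R) × (Γ ⊢ t ∶ T) × (Γ ⊢ r ∶ R)))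
mainTheorem7 𝕊 Γ t r S d = left , right , ≡-+ , ⊢left , ⊢right
  where open Generation 𝕊
        open Splits (split d sum)
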